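{- Let $f:2^{\mathcal N}\to\mathbb{R}_{\ge0}$ be monotone and submodular and $k\ge1$ an integer. Consider the algorithm that initializes $A\gets\emptyset$ and processes the elements $u\in\mathcal N$ one at a time in some fixed order, adding $u$ to $A$ iff $f(A\cup\{u\})-f(A)\ge f(A)/k$ for the current $A$, and let $A'$ be the set of the last $k$ elements added to $A$ ($A'=A$ if $|A|<k$). At termination, $f(A)\le2f(A')$.
   Context: $f$ submodular: $f(S\cup\{x\})-f(S)\ge f(T\cup\{x\})-f(T)$ for $S\subseteq T$, $x\notin T$; monotone: $f(S)\le f(T)$ for $S\subseteq T$.
   Formalization: The function $f$ takes nonnegative rational values rather than values in $\mathbb{R}_{\ge0}$. -}

module Defs where

open import Data.Nat using (ℕ; NonZero)
open import Data.Fin using (Fin)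
open import Data.Fin.Subset using (Subset; _∪_; ⁅_⁆; ⊥; _⊆_; _∉_)
open import Data.Fin.Permutation using (Permutation′; _⟨$⟩ʳ_)
open import Data.List using (List; []; _∷_; foldr; foldl; map; take; allFin)
open import Data.Integer using (+_)
open import Data.Rational using (ℚ; 0ℚ; _≤_; _-_; _*_; _/_)
open import Data.Rational.Properties using (_≤?_)
open import Data.Bool using (if_then_else_)
open import Relation.Nullary using (does)

NonNegative : ∀ {n} → (Subset n → ℚ) → Set
NonNegative f = ∀ S → 0ℚ ≤ f S

Monotone : ∀ {n} → (Subset n → ℚ) → Set
Monotone f = ∀ S T → S ⊆ T → f S ≤ f T

Submodular : ∀ {n} → (Subset n → ℚ) → Set
Submodular f = ∀ S T x → S ⊆ T → x ∉ T →
  f (T ∪ ⁅ x ⁆) - f T ≤ f (S ∪ ⁅ x ⁆) - f S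

toSubset : ∀ {n} → List (Fin n) → Subset n
toSubset = foldr (λ x S → ⁅ x ⁆ ∪ S) ⊥

-- One step of the algorithm.  The state is the list of elements added so
-- far, most recently added first; the current A is toSubset of it.
-- u is added iff f(A ∪ {u}) - f(A) ≥ f(A)/k.
step : ∀ {n} (f : Subset n → ℚ) (k : ℕ) .{{_ : NonZero k}} →
       List (Fin n) → Fin n → List (Fin n)
step f k added u =
  let A = toSubset added in
  if does (f A * ((+ 1) / k) ≤? (f (A ∪ ⁅ u ⁆) - f A))
  then u ∷ added else added

order : ∀ {n} → Permutation′ n → List (Fin n)
order σ = map (σ ⟨$⟩ʳ_) (allFin _)

run : ∀ {n} (f : Subset n → ℚ) (k : ℕ) .{{_ : NonZero k}} →
      Permutation′ n → List (Fin n)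
run f k σ = foldl (step f k) [] (order σ)

finalA : ∀ {n} (f : Subset n → ℚ) (k : ℕ) .{{_ : NonZero k}} →
         Permutation′ n → Subset n
finalA f k σ = toSubset (run f k σ)

finalA' : ∀ {n} (f : Subset n → ℚ) (k : ℕ) .{{_ : NonZero k}} →
          Permutation′ n → Subset n
finalA' f k σ = toSubset (take k (run f k σ))

-- Split the list of added elements as P ++ R with P the last k of them. By submodularity
-- f(P ∪ R) - f(R) ≤ f(P) - f(∅) ≤ f(P). If |P| = k, every element of P was added to a set
-- containing R, so it gained at least f(R)/k; the k gains add up to f(P ∪ R) - f(R) ≥ f(R).
-- Otherwise R = ∅. Either way f(R) ≤ f(P), hence f(P ∪ R) ≤ 2 f(P).
module Submission where

open import Defs
open import Data.Nat using (ℕ; NonZero; zero; suc)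
open import Data.Nat.Properties using (≤-total; m≤n⇒m⊓n≡m)
open import Data.Fin using (Fin)
open import Data.Fin.Subset using (Subset; _∪_; ⁅_⁆; ⊥; _⊆_; _∈_)
open import Data.Fin.Subset.Properties
  using (_∈?_; p⊆p∪q; q⊆p∪q; x∈p∪q⁻; x∈⁅y⁆⇒x≡y; ⊆-antisym; ⊆-min; ∪-comm; ∪-assoc; ∪-identityˡ)
open import Data.Fin.Permutation using (Permutation′)
open import Data.Integer using (+_)
import Data.Integer as ℤ
import Data.Integer.Properties as ℤ
open import Data.Rational using (ℚ; _≤_; _*_; _/_; _+_; _-_; -_; 0ℚ; 1ℚ; mkℚ)
  renaming (NonNegative to NonNegativeℚ)
open import Data.Rational.Properties
  using ( ≤-trans; ≤-reflexive; +-mono-≤; +-monoˡ-≤; +-monoʳ-≤; neg-antimono-≤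
        ; *-monoʳ-≤-nonNeg; normalize-nonNeg; normalize-coprime; /-cong
        ; +-inverseʳ; +-identityʳ; *-identityˡ; *-identityʳ; *-inverseʳ; _≤?_
        ; +-*-commutativeRing; module ≤-Reasoning)
open import Data.Rational.Solver using (module +-*-Solver)
open import Algebra.Bundles using (CommutativeRing)
open import Algebra.Properties.Semiring.Mult (CommutativeRing.semiring +-*-commutativeRing)
  using (_×_; ×-comm-*; ×-assoc-*)
open import Data.Nat.Coprimality using (Coprime; 1-coprimeTo) renaming (sym to ⊥-sym)
open import Data.List using (List; []; _∷_; _++_; take; drop; length; foldl)
open import Data.List.Properties using (length-take; drop-all; take++drop≡id)
open import Data.Sum using (_⊎_; inj₁; inj₂)
open import Relation.Nullary using (Dec; yes; no; does)
open import Data.Bool using (if_then_else_)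
open import Relation.Binary.PropositionalEquality
  using (_≡_; refl; sym; trans; cong; cong₂; subst; module ≡-Reasoning)

p≤q⇒0≤q-p : ∀ {p q} → p ≤ q → 0ℚ ≤ q - p
p≤q⇒0≤q-p {p} {q} p≤q = subst (_≤ q - p) (+-inverseʳ p) (+-monoˡ-≤ (- p) p≤q)

0≤q⇒p-q≤p : ∀ p {q} → 0ℚ ≤ q → p - q ≤ p
0≤q⇒p-q≤p p 0≤q = subst (p - _ ≤_) (+-identityʳ p) (+-monoʳ-≤ p (neg-antimono-≤ 0≤q))

module _ where
  open +-*-Solver

  p≡q+[p-q] : ∀ p q → p ≡ q + (p - q)
  p≡q+[p-q] = solve 2 (λ p q → p := q :+ (p :- q)) refl

  [q+r]-s≡r+[q-s] : ∀ q r s → (q + r) - s ≡ r + (q - s)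
  [q+r]-s≡r+[q-s] = solve 3 (λ q r s → (q :+ r) :- s := r :+ (q :- s)) refl

  2*p≡p+p : ∀ p → ((+ 2) / 1) * p ≡ p + p
  2*p≡p+p = solve 1 (λ p → con ((+ 2) / 1) :* p := p :+ p) refl

m×1≡m/1 : ∀ m → m × 1ℚ ≡ (+ m) / 1
m×1≡m/1 zero = refl
m×1≡m/1 (suc m) = begin
  1ℚ + m × 1ℚ           ≡⟨ cong (_+_ 1ℚ) (trans (m×1≡m/1 m) (normalize-coprime m⊥1)) ⟩
  1ℚ + mkℚ (+ m) 0 m⊥1  ≡⟨ /-cong (cong (ℤ._+_ (+ 1)) (ℤ.*-identityʳ (+ m))) refl ⟩
  (+ suc m) / 1         ∎
  where
  open ≡-Reasoning
  m⊥1 : Coprime m 1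
  m⊥1 = ⊥-sym (1-coprimeTo m)

k*k⁻¹≡1 : ∀ k .{{_ : NonZero k}} → ((+ k) / 1) * ((+ 1) / k) ≡ 1ℚ
k*k⁻¹≡1 (suc m) = begin
  ((+ suc m) / 1) * ((+ 1) / suc m)      ≡⟨ cong₂ _*_ (normalize-coprime k⊥1) (normalize-coprime 1⊥k) ⟩
  mkℚ (+ suc m) 0 k⊥1 * mkℚ (+ 1) m 1⊥k  ≡⟨ *-inverseʳ (mkℚ (+ suc m) 0 k⊥1) ⟩
  1ℚ                                     ∎
  where
  open ≡-Reasoning
  1⊥k : Coprime 1 (suc m)
  1⊥k = 1-coprimeTo (suc m)
  k⊥1 : Coprime (suc m) 1
  k⊥1 = ⊥-sym 1⊥k

k×[p*k⁻¹]≡p : ∀ k .{{_ : NonZero k}} p → k × (p * ((+ 1) / k)) ≡ p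
k×[p*k⁻¹]≡p k p = begin
  k × (p * k⁻¹)         ≡⟨ ×-comm-* k p k⁻¹ ⟨
  p * (k × k⁻¹)         ≡⟨ cong (λ q → p * (k × q)) (*-identityˡ k⁻¹) ⟨
  p * (k × (1ℚ * k⁻¹))  ≡⟨ cong (p *_) (×-assoc-* k 1ℚ k⁻¹) ⟨
  p * ((k × 1ℚ) * k⁻¹)  ≡⟨ cong (λ q → p * (q * k⁻¹)) (m×1≡m/1 k) ⟩
  p * ((+ k) / 1 * k⁻¹) ≡⟨ cong (p *_) (k*k⁻¹≡1 k) ⟩
  p * 1ℚ                ≡⟨ *-identityʳ p ⟩
  p                     ∎
  where
  open ≡-Reasoning
  k⁻¹ : ℚ
  k⁻¹ = (+ 1) / k

module _ {n : ℕ} where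

  x∈p⇒p∪⁅x⁆≡p : ∀ {x : Fin n} {p} → x ∈ p → p ∪ ⁅ x ⁆ ≡ p
  x∈p⇒p∪⁅x⁆≡p {x} {p} x∈p = ⊆-antisym p∪⁅x⁆⊆p (p⊆p∪q ⁅ x ⁆)
    where
    p∪⁅x⁆⊆p : p ∪ ⁅ x ⁆ ⊆ p
    p∪⁅x⁆⊆p y∈p∪⁅x⁆ with x∈p∪q⁻ p ⁅ x ⁆ y∈p∪⁅x⁆
    ... | inj₁ y∈p    = y∈p
    ... | inj₂ y∈⁅x⁆ rewrite x∈⁅y⁆⇒x≡y x y∈⁅x⁆ = x∈p

  toSubset-++ : (P R : List (Fin n)) → toSubset (P ++ R) ≡ toSubset P ∪ toSubset R
  toSubset-++ []      R = sym (∪-identityˡ (toSubset R))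
  toSubset-++ (a ∷ P) R = trans (cong (⁅ a ⁆ ∪_) (toSubset-++ P R)) (sym (∪-assoc ⁅ a ⁆ (toSubset P) (toSubset R)))

  toSubset-++⁺ˡ : (P R : List (Fin n)) → toSubset P ⊆ toSubset (P ++ R)
  toSubset-++⁺ˡ P R = subst (toSubset P ⊆_) (sym (toSubset-++ P R)) (p⊆p∪q (toSubset R))

  toSubset-++⁺ʳ : (P R : List (Fin n)) → toSubset R ⊆ toSubset (P ++ R)
  toSubset-++⁺ʳ P R = subst (toSubset R ⊆_) (sym (toSubset-++ P R)) (q⊆p∪q (toSubset P) (toSubset R))

length-take≡⊎drop≡[] : ∀ {a} {A : Set a} m (L : List A) → length (take m L) ≡ m ⊎ drop m L ≡ []
length-take≡⊎drop≡[] m L with ≤-total m (length L)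
... | inj₁ m≤∣L∣ = inj₁ (trans (length-take m L) (m≤n⇒m⊓n≡m m≤∣L∣))
... | inj₂ ∣L∣≤m = inj₂ (drop-all m L ∣L∣≤m)

module _ {n : ℕ} (f : Subset n → ℚ) where

  f⟦_⟧ : List (Fin n) → ℚ
  f⟦ L ⟧ = f (toSubset L)

  Δ : Subset n → Fin n → ℚ
  Δ S x = f (S ∪ ⁅ x ⁆) - f S

  ∷-telescope : ∀ a L R → f⟦ a ∷ L ⟧ - f⟦ R ⟧ ≡ Δ (toSubset L) a + (f⟦ L ⟧ - f⟦ R ⟧)
  ∷-telescope a L R = begin
    f (⁅ a ⁆ ∪ S) - f⟦ R ⟧   ≡⟨ cong (λ T → f T - f⟦ R ⟧) (∪-comm ⁅ a ⁆ S) ⟩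
    f (S ∪ ⁅ a ⁆) - f⟦ R ⟧   ≡⟨ cong (_- f⟦ R ⟧) (p≡q+[p-q] (f (S ∪ ⁅ a ⁆)) (f S)) ⟩
    (f S + Δ S a) - f⟦ R ⟧   ≡⟨ [q+r]-s≡r+[q-s] (f S) (Δ S a) f⟦ R ⟧ ⟩
    Δ S a + (f S - f⟦ R ⟧)   ∎
    where
    open ≡-Reasoning
    S : Subset n
    S = toSubset L

  module _ (mono : Monotone f) (sub : Submodular f) where

    Δ-antitone : ∀ {S T} x → S ⊆ T → Δ T x ≤ Δ S x
    Δ-antitone {S} {T} x S⊆T with x ∈? T
    ... | no x∉T  = sub S T x S⊆T x∉T
    ... | yes x∈T = begin
      Δ T x      ≡⟨ cong (λ U → f U - f T) (x∈p⇒p∪⁅x⁆≡p x∈T) ⟩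
      f T - f T  ≡⟨ +-inverseʳ (f T) ⟩
      0ℚ         ≤⟨ p≤q⇒0≤q-p (mono S (S ∪ ⁅ x ⁆) (p⊆p∪q ⁅ x ⁆)) ⟩
      Δ S x      ∎
      where open ≤-Reasoning

    ++-gain-upper : ∀ P R → f⟦ P ++ R ⟧ - f⟦ R ⟧ ≤ f⟦ P ⟧ - f ⊥
    ++-gain-upper []      R = ≤-reflexive (trans (+-inverseʳ f⟦ R ⟧) (sym (+-inverseʳ (f ⊥))))
    ++-gain-upper (a ∷ P) R = begin
      f⟦ a ∷ P ++ R ⟧ - f⟦ R ⟧                           ≡⟨ ∷-telescope a (P ++ R) R ⟩
      Δ (toSubset (P ++ R)) a + (f⟦ P ++ R ⟧ - f⟦ R ⟧)   ≤⟨ +-mono-≤ (Δ-antitone a (toSubset-++⁺ˡ P R)) (++-gain-upper P R) ⟩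
      Δ (toSubset P) a + (f⟦ P ⟧ - f ⊥)                  ≡⟨ ∷-telescope a P [] ⟨
      f⟦ a ∷ P ⟧ - f ⊥                                   ∎
      where open ≤-Reasoning

  module _ (k : ℕ) .{{_ : NonZero k}} where

    k⁻¹ : ℚ
    k⁻¹ = (+ 1) / k

    data Admissible : List (Fin n) → Set where
      []  : Admissible []
      _∷_ : ∀ {a L} → f⟦ L ⟧ * k⁻¹ ≤ Δ (toSubset L) a → Admissible L → Admissible (a ∷ L)

    step-admissible : ∀ {L} u → Admissible L → Admissible (step f k L u)
    -- The test is only visible after unfolding step, so it cannot be abstracted by with.
    step-admissible {L} u adm = admissible-if (f⟦ L ⟧ * k⁻¹ ≤? Δ (toSubset L) u)
      where
      admissible-if : (d : Dec (f⟦ L ⟧ * k⁻¹ ≤ Δ (toSubset L) u)) → Admissible (if does d then u ∷ L else L)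
      admissible-if (yes passes) = passes ∷ adm
      admissible-if (no _)       = adm

    foldl-step-admissible : ∀ {L} us → Admissible L → Admissible (foldl (step f k) L us)
    foldl-step-admissible []       adm = adm
    foldl-step-admissible (u ∷ us) adm = foldl-step-admissible us (step-admissible u adm)

    ++-gain-lower : Monotone f → ∀ P R → Admissible (P ++ R) →
                    length P × (f⟦ R ⟧ * k⁻¹) ≤ f⟦ P ++ R ⟧ - f⟦ R ⟧
    ++-gain-lower mono []      R _ = ≤-reflexive (sym (+-inverseʳ f⟦ R ⟧))
    ++-gain-lower mono (a ∷ P) R (passes ∷ adm) = begin
      f⟦ R ⟧ * k⁻¹ + length P × (f⟦ R ⟧ * k⁻¹)          ≤⟨ +-mono-≤ gain-bound (++-gain-lower mono P R adm) ⟩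
      Δ (toSubset (P ++ R)) a + (f⟦ P ++ R ⟧ - f⟦ R ⟧)  ≡⟨ ∷-telescope a (P ++ R) R ⟨
      f⟦ a ∷ P ++ R ⟧ - f⟦ R ⟧                          ∎
      where
      open ≤-Reasoning
      instance
        k⁻¹-nonNeg : NonNegativeℚ k⁻¹
        k⁻¹-nonNeg = normalize-nonNeg 1 k
      gain-bound : f⟦ R ⟧ * k⁻¹ ≤ Δ (toSubset (P ++ R)) a
      gain-bound = ≤-trans (*-monoʳ-≤-nonNeg k⁻¹ (mono _ _ (toSubset-++⁺ʳ P R))) passes

    module _ (nn : NonNegative f) (mono : Monotone f) (sub : Submodular f) where

      ++-gain≤prefix : ∀ P R → f⟦ P ++ R ⟧ - f⟦ R ⟧ ≤ f⟦ P ⟧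
      ++-gain≤prefix P R = ≤-trans (++-gain-upper mono sub P R) (0≤q⇒p-q≤p f⟦ P ⟧ (nn ⊥))

      suffix≤prefix : ∀ P R → Admissible (P ++ R) → length P ≡ k ⊎ R ≡ [] → f⟦ R ⟧ ≤ f⟦ P ⟧
      suffix≤prefix P R adm (inj₁ ∣P∣≡k) = begin
        f⟦ R ⟧                          ≡⟨ k×[p*k⁻¹]≡p k f⟦ R ⟧ ⟨
        k × (f⟦ R ⟧ * k⁻¹)              ≡⟨ cong (_× (f⟦ R ⟧ * k⁻¹)) ∣P∣≡k ⟨
        length P × (f⟦ R ⟧ * k⁻¹)       ≤⟨ ++-gain-lower mono P R adm ⟩
        f⟦ P ++ R ⟧ - f⟦ R ⟧            ≤⟨ ++-gain≤prefix P R ⟩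
        f⟦ P ⟧                          ∎
        where open ≤-Reasoning
      suffix≤prefix P .[] _ (inj₂ refl) = mono ⊥ (toSubset P) (⊆-min (toSubset P))

      admissible⇒≤2*take : ∀ {L} → Admissible L → f⟦ L ⟧ ≤ ((+ 2) / 1) * f⟦ take k L ⟧
      admissible⇒≤2*take {L} adm = subst (λ M → f⟦ M ⟧ ≤ ((+ 2) / 1) * f⟦ P ⟧) (take++drop≡id k L) (begin
        f⟦ P ++ R ⟧                     ≡⟨ p≡q+[p-q] f⟦ P ++ R ⟧ f⟦ R ⟧ ⟩
        f⟦ R ⟧ + (f⟦ P ++ R ⟧ - f⟦ R ⟧) ≤⟨ +-mono-≤ (suffix≤prefix P R adm′ (length-take≡⊎drop≡[] k L)) (++-gain≤prefix P R) ⟩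
        f⟦ P ⟧ + f⟦ P ⟧                 ≡⟨ 2*p≡p+p f⟦ P ⟧ ⟨
        ((+ 2) / 1) * f⟦ P ⟧            ∎)
        where
        open ≤-Reasoning
        P R : List (Fin n)
        P = take k L
        R = drop k L
        adm′ : Admissible (P ++ R)
        adm′ = subst Admissible (sym (take++drop≡id k L)) adm

lemma10 : (n : ℕ) (f : Subset n → ℚ) → NonNegative f → Monotone f → Submodular f →
          (k : ℕ) .{{_ : NonZero k}} → (σ : Permutation′ n) →
          f (finalA f k σ) ≤ ((+ 2) / 1) * f (finalA' f k σ)
lemma10 n f nn mono sub k σ = admissible⇒≤2*take f k nn mono sub (foldl-step-admissible f k (order σ) [])
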